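{- Let $a\in\mathbb{N}$, $a\ge3$, $S=\langle a,a+1,a+2\rangle$ and $r\in\llbracket 0,\mathscr{L}_a)\!)$. Then $r\in S$ if and only if there exist $d,i,c\in\mathbb{Z}$ with $d\ge1$, $i\ge0$ and $c\in\Gamma_i$ such that $r=(a+1)(2d-2+i)+c$. In that case $(d,i,c)=(\delta_r,\iota_r,c_r)$, and in particular $2d-2+i=\ell_r$.
   Context: $\mathbb{N}=\{0,1,2,\dots\}$. $S=\langle a,a+1,a+2\rangle=\{\alpha_1a+\alpha_2(a+1)+\alpha_3(a+2):\alpha_i\in\mathbb{N}\}$. $\operatorname{F}(r,S)=\{\alpha\in\mathbb{N}^3:\alpha_1a+\alpha_2(a+1)+\alpha_3(a+2)=r\}$ and $\delta_r$ denotes its cardinality (the denumerant of $r$). $\mathscr{L}_a=\lfloor a/2\rfloor (a+2)$ if $a$ is even, and $\mathscr{L}_a=(\lfloor a/2\rfloor+2)a$ if $a$ is odd; $\llbracket x,y)\!)=\{n\in\mathbb{Z}:x\le n<y\}$. For $r\in\mathbb{N}$: $\ell_r=\lfloor r/a\rfloor$, $\varepsilon_r=r-a\ell_r$, $\phi_r=(\phi_{r,1},\phi_{r,2},\phi_{r,3})=(\ell_r-\lfloor(\varepsilon_r+1)/2\rfloor,\ \varepsilon_r-2\lfloor\varepsilon_r/2\rfloor,\ \lfloor\varepsilon_r/2\rfloor)$; when $\phi_r\in\mathbb{N}^3$, $\iota_r=\phi_{r,2}+|\phi_{r,1}-\phi_{r,3}|$ and $c_r=\phi_{r,3}-\phi_{r,1}$.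 For $i\in\mathbb{N}$: $\Gamma_0=\{0\}$, $\Gamma_1=\{ -1,0,1\}$, and $\Gamma_i=\{ -i,-i+1,i-1,i\}$ for $i\ge2$. -}

module Defs where

open import Data.Nat using (ℕ; zero; suc; _+_; _*_; _∸_; _≤_; _<_; NonZero)
open import Data.Nat.DivMod using (_/_; _%_)
open import Data.Integer as ℤ using (ℤ; +_; ∣_∣)
open import Data.Product using (Σ; _×_; _,_)
open import Data.Sum using (_⊎_)
open import Relation.Binary.PropositionalEquality using (_≡_)

F : ℕ → ℕ → Set
F a r = Σ (ℕ × ℕ × ℕ) λ { (α₁ , α₂ , α₃) → α₁ * a + α₂ * (a + 1) + α₃ * (a + 2) ≡ r }

InS : ℕ → ℕ → Set
InS a r = F a r

L : ℕ → ℕ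
L a with a % 2
... | zero  = (a / 2) * (a + 2)
... | suc _ = (a / 2 + 2) * a

ℓ : (a : ℕ) → .{{NonZero a}} → ℕ → ℕ
ℓ a r = r / a

ε : (a : ℕ) → .{{NonZero a}} → ℕ → ℕ
ε a r = r ∸ a * ℓ a r

-- components of φ_r, as integers (φ_{r,1} may be negative in general)
φ₁ : (a : ℕ) → .{{NonZero a}} → ℕ → ℤ
φ₁ a r = + ℓ a r ℤ.- + ((ε a r + 1) / 2)

φ₂ : (a : ℕ) → .{{NonZero a}} → ℕ → ℤ
φ₂ a r = + (ε a r ∸ 2 * (ε a r / 2))

φ₃ : (a : ℕ) → .{{NonZero a}} → ℕ → ℤ
φ₃ a r = + (ε a r / 2)

-- ι_r and c_r (meaningful when φ_r ∈ ℕ³)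
ι : (a : ℕ) → .{{NonZero a}} → ℕ → ℤ
ι a r = φ₂ a r ℤ.+ + ∣ φ₁ a r ℤ.- φ₃ a r ∣

cᵣ : (a : ℕ) → .{{NonZero a}} → ℕ → ℤ
cᵣ a r = φ₃ a r ℤ.- φ₁ a r

InΓ : ℕ → ℤ → Set
InΓ zero c = c ≡ + 0
InΓ (suc zero) c = c ≡ ℤ.- + 1 ⊎ c ≡ + 0 ⊎ c ≡ + 1
InΓ (suc (suc k)) c =
  c ≡ ℤ.- + i ⊎ c ≡ ℤ.- + i ℤ.+ + 1 ⊎ c ≡ + i ℤ.- + 1 ⊎ c ≡ + i
  where i = suc (suc k)

{-# OPTIONS --safe #-}
-- Since x a + y (a+1) + z (a+2) = (a+1)(x+y+z) + (z − x), a factorization of r of length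
-- n = x+y+z satisfies r = (a+1) n + (z − x) with |z − x| ≤ n, and below 𝓛_a this forces
-- n = ⌊r/a⌋ = ℓ_r. So the factorizations of r are the (x, y, z) with x+y+z = ℓ_r and
-- z − x = r − (a+1) ℓ_r. Writing i = e + |c| with e ∈ {0,1} and c = p − q with p q = 0,
-- these are exactly (j + q, e + 2(d−1−j), j + p) for 0 ≤ j < d, so δ_r = d; and
-- ε_r = 2(d−1+p) + e, from which φ_r, ι_r = i and c_r = c are read off. Conversely a
-- factorization with y = e + 2h gives d = min(x,z) + h + 1, i = e + |z − x|, c = z − x.
module Submission where

open import Defs
open import Data.Fin using (Fin; zero; toℕ; fromℕ<)
open import Data.Fin.Properties using (toℕ-fromℕ<; toℕ-injective; toℕ≤pred[n])
open import Data.Integer as ℤ using (ℤ; +_; -[1+_]; ∣_∣)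
import Data.Integer.Properties as ℤ
import Data.Integer.Tactic.RingSolver as ℤ-Ring
open import Data.Nat using (ℕ; suc; z≤n; s≤s; _+_; _*_; _∸_; _≤_; _<_; NonZero)
open import Data.Nat.DivMod using (_/_; _%_; m≡m%n+[m/n]*n; m%n<n; m*n/n≡m; m/n*n≤m; /-monoˡ-≤; m<n*o⇒m/o<n)
open import Data.Nat.Properties
import Data.Nat.Tactic.RingSolver as ℕ-Ring
open import Data.Product using (_×_; _,_; proj₁; proj₂; ∃-syntax)
open import Data.Sum using (_⊎_; inj₁; inj₂; swap)
open import Function.Bundles using (_⇔_; _↔_; Equivalence; Inverse; mk⇔; mk↔ₛ′)
open import Relation.Binary.PropositionalEquality using (_≡_; refl; sym; trans; cong; cong₂; subst; subst₂; module ≡-Reasoning)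

-- c ∈ Γ_i iff i = e + |c| for some e ≤ 1; the sign of c is kept by writing c = p − q with p q = 0.
data ΓDecomposition : ℕ → ℤ → Set where
  decompose : ∀ e p q → e ≤ 1 → p ≡ 0 ⊎ q ≡ 0 → ΓDecomposition (e + p + q) (+ p ℤ.- + q)

decompose⁺ : ∀ e p → e ≤ 1 → ΓDecomposition (e + p) (+ p)
decompose⁺ e p e≤1 =
  subst₂ ΓDecomposition (+-identityʳ (e + p)) (ℤ.+-identityʳ (+ p)) (decompose e p 0 e≤1 (inj₂ refl))

InΓ⇒ΓDecomposition : ∀ i c → InΓ i c → ΓDecomposition i c
InΓ⇒ΓDecomposition 0 _ refl = decompose 0 0 0 z≤n (inj₁ refl)
InΓ⇒ΓDecomposition 1 _ (inj₁ refl) = decompose 0 0 1 z≤n (inj₁ refl)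
InΓ⇒ΓDecomposition 1 _ (inj₂ (inj₁ refl)) = decompose 1 0 0 (s≤s z≤n) (inj₁ refl)
InΓ⇒ΓDecomposition 1 _ (inj₂ (inj₂ refl)) = decompose 0 1 0 z≤n (inj₂ refl)
InΓ⇒ΓDecomposition (suc (suc k)) _ (inj₁ refl) = decompose 0 0 (2 + k) z≤n (inj₁ refl)
InΓ⇒ΓDecomposition (suc (suc k)) _ (inj₂ (inj₁ refl)) = decompose 1 0 (1 + k) (s≤s z≤n) (inj₁ refl)
InΓ⇒ΓDecomposition (suc (suc k)) _ (inj₂ (inj₂ (inj₁ refl))) = decompose⁺ 1 (1 + k) (s≤s z≤n)
InΓ⇒ΓDecomposition (suc (suc k)) _ (inj₂ (inj₂ (inj₂ refl))) = decompose⁺ 0 (2 + k) z≤n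

InΓ-nonneg : ∀ e p → e ≤ 1 → InΓ (e + p) (+ p)
InΓ-nonneg 0 0 _ = refl
InΓ-nonneg 0 1 _ = inj₂ (inj₂ refl)
InΓ-nonneg 0 (suc (suc k)) _ = inj₂ (inj₂ (inj₂ refl))
InΓ-nonneg 1 0 _ = inj₂ (inj₁ refl)
InΓ-nonneg 1 (suc k) _ = inj₂ (inj₂ (inj₁ refl))
InΓ-nonneg (suc (suc _)) _ (s≤s ())

InΓ-nonpos : ∀ e q → e ≤ 1 → InΓ (e + q) (ℤ.- + q)
InΓ-nonpos 0 0 _ = refl
InΓ-nonpos 0 1 _ = inj₁ refl
InΓ-nonpos 0 (suc (suc k)) _ = inj₁ refl
InΓ-nonpos 1 0 _ = inj₂ (inj₁ refl)
InΓ-nonpos 1 (suc k) _ = inj₂ (inj₁ refl)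
InΓ-nonpos (suc (suc _)) _ (s≤s ())

ΓDecomposition⇒InΓ : ∀ {i c} → ΓDecomposition i c → InΓ i c
ΓDecomposition⇒InΓ (decompose e _ q e≤1 (inj₁ refl)) =
  subst₂ InΓ (cong (_+ q) (sym (+-identityʳ e))) (sym (ℤ.+-identityˡ (ℤ.- + q))) (InΓ-nonpos e q e≤1)
ΓDecomposition⇒InΓ (decompose e p _ e≤1 (inj₂ refl)) =
  subst₂ InΓ (sym (+-identityʳ (e + p))) (sym (ℤ.+-identityʳ (+ p))) (InΓ-nonneg e p e≤1)

/-unique : ∀ {m d k} .{{_ : NonZero d}} → k * d ≤ m → m < suc k * d → m / d ≡ k
/-unique {m} {d} {k} kd≤m m<[1+k]d =
  ≤-antisym (≤-pred (m<n*o⇒m/o<n m<[1+k]d)) (≤-trans (≤-reflexive (sym (m*n/n≡m k d))) (/-monoˡ-≤ d kd≤m))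

[2m+e]/2≡m : ∀ m {e} → e ≤ 1 → (2 * m + e) / 2 ≡ m
[2m+e]/2≡m m {e} e≤1 = /-unique (≤-trans (≤-reflexive (*-comm m 2)) (m≤m+n (2 * m) e))
                                 (s≤s (≤-trans (+-monoʳ-≤ (2 * m) e≤1) (≤-reflexive (identity m))))
  where
  identity : ∀ m → 2 * m + 1 ≡ suc (m * 2)
  identity = ℕ-Ring.solve-∀

[2m+e+1]/2≡m+e : ∀ m {e} → e ≤ 1 → (2 * m + e + 1) / 2 ≡ m + e
[2m+e+1]/2≡m+e m z≤n =
  trans (cong (_/ 2) (identity m)) (trans ([2m+e]/2≡m m (s≤s z≤n)) (sym (+-identityʳ m)))
  where
  identity : ∀ m → 2 * m + 0 + 1 ≡ 2 * m + 1
  identity = ℕ-Ring.solve-∀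
[2m+e+1]/2≡m+e m (s≤s z≤n) = trans (cong (_/ 2) (identity m)) ([2m+e]/2≡m (m + 1) z≤n)
  where
  identity : ∀ m → 2 * m + 1 + 1 ≡ 2 * (m + 1) + 0
  identity = ℕ-Ring.solve-∀

L≤[1+n]*a : ∀ {a} n → a ≤ n * 2 → L a ≤ suc n * a
L≤[1+n]*a {a} n a≤2n with a % 2 | m≡m%n+[m/n]*n a 2 | m%n<n a 2
... | 0           | a≡2h   | _ = even (a / 2) a≡2h a≤2n
  where
  open ≤-Reasoning
  identity : ∀ h → h * (h * 2 + 2) ≡ suc h * (h * 2)
  identity = ℕ-Ring.solve-∀
  even : ∀ {a} h → a ≡ h * 2 → a ≤ n * 2 → h * (a + 2) ≤ suc n * a
  even h refl 2h≤2n = begin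
    h * (h * 2 + 2)  ≡⟨ identity h ⟩
    suc h * (h * 2)  ≤⟨ *-monoˡ-≤ (h * 2) (s≤s (*-cancelʳ-≤ h n 2 2h≤2n)) ⟩
    suc n * (h * 2)  ∎
... | 1           | a≡2h+1 | _ = odd (a / 2) a≡2h+1 a≤2n
  where
  odd : ∀ {a} h → a ≡ 1 + h * 2 → a ≤ n * 2 → (h + 2) * a ≤ suc n * a
  odd {a} h refl 2h<2n = *-monoˡ-≤ a (≤-trans (≤-reflexive (+-comm h 2)) (s≤s (*-cancelʳ-< 2 h n 2h<2n)))
... | suc (suc _) | _      | s≤s (s≤s ())

-- The one use of r < 𝓛_a: r lies in [n a, (n+1) a) directly when 2n < a, and because
-- r < 𝓛_a ≤ (n+1) a otherwise.
ℓ≡-of-near-multiple : ∀ {a} .{{_ : NonZero a}} {r n p q} →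
  r < L a → r + q ≡ (a + 1) * n + p → p ≤ n → q ≤ n → ℓ a r ≡ n
ℓ≡-of-near-multiple {a} {r} {n} {p} {q} r<L r+q≡ p≤n q≤n = /-unique na≤r r<[1+n]a
  where
  open ≤-Reasoning
  identity : ∀ a n p → (a + 1) * n + p ≡ n * a + (n + p)
  identity = ℕ-Ring.solve-∀
  n+n≡n*2 : ∀ n → n + n ≡ n * 2
  n+n≡n*2 = ℕ-Ring.solve-∀
  r+q≡na+n+p : r + q ≡ n * a + (n + p)
  r+q≡na+n+p = trans r+q≡ (identity a n p)
  na≤r : n * a ≤ r
  na≤r = +-cancelʳ-≤ q (n * a) r (begin
    n * a + q        ≤⟨ +-monoʳ-≤ (n * a) (≤-trans q≤n (m≤m+n n p)) ⟩
    n * a + (n + p)  ≡⟨ sym r+q≡na+n+p ⟩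
    r + q            ∎)
  r<[1+n]a : r < suc n * a
  r<[1+n]a with ≤-<-connex a (n * 2)
  ... | inj₁ a≤2n = <-≤-trans r<L (L≤[1+n]*a n a≤2n)
  ... | inj₂ 2n<a = begin-strict
    r                ≤⟨ m≤m+n r q ⟩
    r + q            ≡⟨ r+q≡na+n+p ⟩
    n * a + (n + p)  ≤⟨ +-monoʳ-≤ (n * a) (+-monoʳ-≤ n p≤n) ⟩
    n * a + (n + n)  ≡⟨ cong (λ k → n * a + k) (n+n≡n*2 n) ⟩
    n * a + n * 2    <⟨ +-monoʳ-< (n * a) 2n<a ⟩
    n * a + a        ≡⟨ +-comm (n * a) a ⟩
    suc n * a        ∎

ε+q≡ : ∀ {a} .{{_ : NonZero a}} {r q s} → r + q ≡ a * ℓ a r + s → ε a r + q ≡ s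
ε+q≡ {a} {r} {q} {s} r+q≡ = +-cancelˡ-≡ (a * ℓ a r) (ε a r + q) s (begin
  a * ℓ a r + (ε a r + q)  ≡⟨ sym (+-assoc (a * ℓ a r) (ε a r) q) ⟩
  a * ℓ a r + ε a r + q    ≡⟨ cong (_+ q) (m+[n∸m]≡n (≤-trans (≤-reflexive (*-comm a (r / a))) (m/n*n≤m r a))) ⟩
  r + q                    ≡⟨ r+q≡ ⟩
  a * ℓ a r + s            ∎)
  where open ≡-Reasoning

weight-identity : ∀ a x y z → x * a + y * (a + 1) + z * (a + 2) + x ≡ (a + 1) * (x + y + z) + z
weight-identity = ℕ-Ring.solve-∀

shape-identity : ∀ a m h e p q →
  (m + q) * a + (e + 2 * h) * (a + 1) + (m + p) * (a + 2) + q ≡ (a + 1) * (2 * (m + h) + (e + p + q)) + p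
shape-identity = ℕ-Ring.solve-∀

common-summand : ∀ {x z p q} → x + p ≡ z + q → p ≡ 0 ⊎ q ≡ 0 → x ∸ q + q ≡ x × x ∸ q + p ≡ z
common-summand {x} {z} {q = q} x≡z+q (inj₁ refl) rewrite +-identityʳ x | x≡z+q | m+n∸n≡m z q =
  refl , +-identityʳ z
common-summand {x} {z} x+p≡z (inj₂ refl) = +-identityʳ x , trans x+p≡z (+-identityʳ z)

∣m⊖n∣≡m+n : ∀ {m n} → m ≡ 0 ⊎ n ≡ 0 → ∣ m ℤ.⊖ n ∣ ≡ m + n
∣m⊖n∣≡m+n {n = n} (inj₁ refl) = ℤ.∣⊖∣-≤ z≤n
∣m⊖n∣≡m+n {m} (inj₂ refl) = trans (ℤ.∣m⊖n∣≡∣n⊖m∣ m 0) (trans (ℤ.∣⊖∣-≤ z≤n) (sym (+-identityʳ m)))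

2[1+d]-2+i≡2d+i : ∀ d i → + 2 ℤ.* + suc d ℤ.- + 2 ℤ.+ + i ≡ + (2 * d + i)
2[1+d]-2+i≡2d+i d i = trans (identity (+ d) (+ i)) (cong (ℤ._+ + i) (sym (ℤ.pos-* 2 d)))
  where
  identity : ∀ d i → + 2 ℤ.* (+ 1 ℤ.+ d) ℤ.- + 2 ℤ.+ i ≡ + 2 ℤ.* d ℤ.+ i
  identity = ℤ-Ring.solve-∀

+r≡+m+[p-q]⇔r+q≡m+p : ∀ r m p q → (+ r ≡ + m ℤ.+ (+ p ℤ.- + q)) ⇔ (r + q ≡ m + p)
+r≡+m+[p-q]⇔r+q≡m+p r m p q = mk⇔ to from
  where
  open ≡-Reasoning
  shift : ∀ x y z → (x ℤ.+ (y ℤ.- z)) ℤ.+ z ≡ x ℤ.+ y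
  shift = ℤ-Ring.solve-∀
  unshift : ∀ x z → x ≡ (x ℤ.+ z) ℤ.- z
  unshift = ℤ-Ring.solve-∀
  to : + r ≡ + m ℤ.+ (+ p ℤ.- + q) → r + q ≡ m + p
  to eq = ℤ.+-injective (trans (cong (ℤ._+ + q) eq) (shift (+ m) (+ p) (+ q)))
  from : r + q ≡ m + p → + r ≡ + m ℤ.+ (+ p ℤ.- + q)
  from eq = begin
    + r                           ≡⟨ unshift (+ r) (+ q) ⟩
    + (r + q) ℤ.- + q             ≡⟨ cong (λ k → + k ℤ.- + q) eq ⟩
    (+ m ℤ.+ + p) ℤ.- + q         ≡⟨ ℤ.+-assoc (+ m) (+ p) (ℤ.- + q) ⟩
    + m ℤ.+ (+ p ℤ.- + q)         ∎

representation-equation⇔ : ∀ a r d i p q →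
  (+ r ≡ (+ a ℤ.+ + 1) ℤ.* (+ 2 ℤ.* + suc d ℤ.- + 2 ℤ.+ + i) ℤ.+ (+ p ℤ.- + q))
    ⇔ (r + q ≡ (a + 1) * (2 * d + i) + p)
representation-equation⇔ a r d i p q
  rewrite 2[1+d]-2+i≡2d+i d i | sym (ℤ.pos-* (a + 1) (2 * d + i)) =
  +r≡+m+[p-q]⇔r+q≡m+p r ((a + 1) * (2 * d + i)) p q

F-≡ : ∀ {a r x y z x′ y′ z′}
        {w : x * a + y * (a + 1) + z * (a + 2) ≡ r} {w′ : x′ * a + y′ * (a + 1) + z′ * (a + 2) ≡ r} →
        x ≡ x′ → y ≡ y′ → z ≡ z′ → _≡_ {A = F a r} ((x , y , z) , w) ((x′ , y′ , z′) , w′)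
F-≡ {w = w} {w′} refl refl refl = cong (_ ,_) (≡-irrelevant w w′)

-- d is the paper's d − 1, so that δ_r = d + 1.
module Fibre (a : ℕ) .{{_ : NonZero a}} {r d e p q : ℕ} (r<L : r < L a) (e≤1 : e ≤ 1)
             (p≡0⊎q≡0 : p ≡ 0 ⊎ q ≡ 0) (r+q≡ : r + q ≡ (a + 1) * (2 * d + (e + p + q)) + p) where

  n : ℕ
  n = 2 * d + (e + p + q)

  ℓ≡n : ℓ a r ≡ n
  ℓ≡n = ℓ≡-of-near-multiple r<L r+q≡ p≤n q≤n
    where
    p≤n : p ≤ n
    p≤n = ≤-trans (≤-trans (m≤n+m p e) (m≤m+n (e + p) q)) (m≤n+m (e + p + q) (2 * d))
    q≤n : q ≤ n
    q≤n = ≤-trans (m≤n+m q (e + p)) (m≤n+m (e + p + q) (2 * d))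

  toF : Fin (suc d) → F a r
  toF j = (toℕ j + q , e + 2 * (d ∸ toℕ j) , toℕ j + p) , +-cancelʳ-≡ q _ r (begin
    _                                                ≡⟨ shape-identity a (toℕ j) (d ∸ toℕ j) e p q ⟩
    (a + 1) * (2 * (toℕ j + (d ∸ toℕ j)) + (e + p + q)) + p
                                                     ≡⟨ cong (λ k → (a + 1) * (2 * k + (e + p + q)) + p) (m+[n∸m]≡n (toℕ≤pred[n] j)) ⟩
    (a + 1) * n + p                                  ≡⟨ sym r+q≡ ⟩
    r + q                                            ∎)
    where open ≡-Reasoning

  module Factorization (x y z : ℕ) (w : x * a + y * (a + 1) + z * (a + 2) ≡ r) where
    private
      r+x≡ : r + x ≡ (a + 1) * (x + y + z) + z
      r+x≡ = trans (cong (_+ x) (sym w)) (weight-identity a x y z)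

    length≡n : x + y + z ≡ n
    length≡n = trans (sym (ℓ≡-of-near-multiple r<L r+x≡ (m≤n+m z (x + y)) (≤-trans (m≤m+n x y) (m≤m+n (x + y) z)))) ℓ≡n

    x+p≡z+q : x + p ≡ z + q
    x+p≡z+q = +-cancelˡ-≡ r (x + p) (z + q) (begin
      r + (x + p)          ≡⟨ sym (+-assoc r x p) ⟩
      r + x + p            ≡⟨ cong (_+ p) r+x≡ ⟩
      (a + 1) * (x + y + z) + z + p
                           ≡⟨ cong (λ k → (a + 1) * k + z + p) length≡n ⟩
      (a + 1) * n + z + p  ≡⟨ reorder ((a + 1) * n) z p ⟩
      (a + 1) * n + p + z  ≡⟨ cong (_+ z) (sym r+q≡) ⟩
      r + q + z            ≡⟨ reorder′ r q z ⟩
      r + (z + q)          ∎)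
      where
      open ≡-Reasoning
      reorder : ∀ m z p → m + z + p ≡ m + p + z
      reorder = ℕ-Ring.solve-∀
      reorder′ : ∀ r q z → r + q + z ≡ r + (z + q)
      reorder′ = ℕ-Ring.solve-∀

    index : ℕ
    index = x ∸ q

    index+q≡x×index+p≡z : index + q ≡ x × index + p ≡ z
    index+q≡x×index+p≡z = common-summand x+p≡z+q p≡0⊎q≡0

    2index+y≡2d+e : 2 * index + y ≡ 2 * d + e
    2index+y≡2d+e = +-cancelʳ-≡ (p + q) (2 * index + y) (2 * d + e) (begin
      2 * index + y + (p + q)          ≡⟨ regroup index q y p ⟩
      (index + q) + y + (index + p)    ≡⟨ cong₂ (λ s t → s + y + t) (proj₁ index+q≡x×index+p≡z) (proj₂ index+q≡x×index+p≡z) ⟩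
      x + y + z                        ≡⟨ length≡n ⟩
      n                                ≡⟨ regroup′ d e p q ⟩
      2 * d + e + (p + q)              ∎)
      where
      open ≡-Reasoning
      regroup : ∀ j q y p → 2 * j + y + (p + q) ≡ (j + q) + y + (j + p)
      regroup = ℕ-Ring.solve-∀
      regroup′ : ∀ d e p q → 2 * d + (e + p + q) ≡ 2 * d + e + (p + q)
      regroup′ = ℕ-Ring.solve-∀

    index<1+d : index < suc d
    index<1+d = *-cancelˡ-< 2 index (suc d) (begin-strict
      2 * index      ≤⟨ m≤m+n (2 * index) y ⟩
      2 * index + y  ≡⟨ 2index+y≡2d+e ⟩
      2 * d + e      ≤⟨ +-monoʳ-≤ (2 * d) e≤1 ⟩
      2 * d + 1      <⟨ ≤-reflexive (identity d) ⟩
      2 * suc d      ∎)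
      where
      open ≤-Reasoning
      identity : ∀ d → suc (2 * d + 1) ≡ 2 * suc d
      identity = ℕ-Ring.solve-∀

    e+2[d∸index]≡y : e + 2 * (d ∸ index) ≡ y
    e+2[d∸index]≡y = sym (+-cancelˡ-≡ (2 * index) y (e + 2 * (d ∸ index)) (begin
      2 * index + y                          ≡⟨ 2index+y≡2d+e ⟩
      2 * d + e                              ≡⟨ cong (λ k → 2 * k + e) (sym (m+[n∸m]≡n (≤-pred index<1+d))) ⟩
      2 * (index + (d ∸ index)) + e          ≡⟨ regroup index (d ∸ index) e ⟩
      2 * index + (e + 2 * (d ∸ index))      ∎))
      where
      open ≡-Reasoning
      regroup : ∀ j k e → 2 * (j + k) + e ≡ 2 * j + (e + 2 * k)
      regroup = ℕ-Ring.solve-∀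

  fromF : F a r → Fin (suc d)
  fromF ((x , y , z) , w) = fromℕ< (Factorization.index<1+d x y z w)

  fromF∘toF : ∀ j → fromF (toF j) ≡ j
  fromF∘toF j = toℕ-injective (trans (toℕ-fromℕ< _) (m+n∸n≡m (toℕ j) q))

  toF∘fromF : ∀ α → toF (fromF α) ≡ α
  toF∘fromF ((x , y , z) , w) = F-≡
    (trans (cong (_+ q) toℕ-fromF) (proj₁ index+q≡x×index+p≡z))
    (trans (cong (λ k → e + 2 * (d ∸ k)) toℕ-fromF) e+2[d∸index]≡y)
    (trans (cong (_+ p) toℕ-fromF) (proj₂ index+q≡x×index+p≡z))
    where
    open Factorization x y z w
    toℕ-fromF : toℕ (fromF ((x , y , z) , w)) ≡ index
    toℕ-fromF = toℕ-fromℕ< _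

  Fin↔F : Fin (suc d) ↔ F a r
  Fin↔F = mk↔ₛ′ toF fromF toF∘fromF fromF∘toF

  ε≡ : ε a r ≡ 2 * (d + p) + e
  ε≡ = +-cancelʳ-≡ q (ε a r) (2 * (d + p) + e) (trans (ε+q≡ r+q≡aℓ+n+p) (regroup d e p q))
    where
    regroup : ∀ d e p q → 2 * d + (e + p + q) + p ≡ 2 * (d + p) + e + q
    regroup = ℕ-Ring.solve-∀
    identity : ∀ a n p → (a + 1) * n + p ≡ a * n + (n + p)
    identity = ℕ-Ring.solve-∀
    r+q≡aℓ+n+p : r + q ≡ a * ℓ a r + (n + p)
    r+q≡aℓ+n+p = trans r+q≡ (trans (identity a n p) (cong (λ k → a * k + (n + p)) (sym ℓ≡n)))

  φ₁≡ : φ₁ a r ≡ + (d + q)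
  φ₁≡ = begin
    + ℓ a r ℤ.- + ((ε a r + 1) / 2)            ≡⟨ cong₂ (λ l k → + l ℤ.- + ((k + 1) / 2)) ℓ≡n ε≡ ⟩
    + n ℤ.- + ((2 * (d + p) + e + 1) / 2)      ≡⟨ cong (λ k → + n ℤ.- + k) ([2m+e+1]/2≡m+e (d + p) e≤1) ⟩
    + n ℤ.- + (d + p + e)                      ≡⟨ cong (λ k → + k ℤ.- + (d + p + e)) (regroup d e p q) ⟩
    + (d + q) ℤ.+ + (d + p + e) ℤ.- + (d + p + e) ≡⟨ cancel (+ (d + q)) (+ (d + p + e)) ⟩
    + (d + q)                                  ∎
    where
    open ≡-Reasoning
    regroup : ∀ d e p q → 2 * d + (e + p + q) ≡ d + q + (d + p + e)
    regroup = ℕ-Ring.solve-∀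
    cancel : ∀ x y → x ℤ.+ y ℤ.- y ≡ x
    cancel = ℤ-Ring.solve-∀

  φ₂≡ : φ₂ a r ≡ + e
  φ₂≡ = cong +_ (begin
    ε a r ∸ 2 * (ε a r / 2)                    ≡⟨ cong (λ k → k ∸ 2 * (k / 2)) ε≡ ⟩
    2 * (d + p) + e ∸ 2 * ((2 * (d + p) + e) / 2)  ≡⟨ cong (λ k → 2 * (d + p) + e ∸ 2 * k) ([2m+e]/2≡m (d + p) e≤1) ⟩
    2 * (d + p) + e ∸ 2 * (d + p)              ≡⟨ m+n∸m≡n (2 * (d + p)) e ⟩
    e                                          ∎)
    where open ≡-Reasoning

  φ₃≡ : φ₃ a r ≡ + (d + p)
  φ₃≡ = cong +_ (trans (cong (_/ 2) ε≡) ([2m+e]/2≡m (d + p) e≤1))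

  ι≡ : ι a r ≡ + (e + p + q)
  ι≡ = begin
    φ₂ a r ℤ.+ + ∣ φ₁ a r ℤ.- φ₃ a r ∣          ≡⟨ cong₂ (λ s t → s ℤ.+ + ∣ t ∣) φ₂≡ (cong₂ ℤ._-_ φ₁≡ φ₃≡) ⟩
    + e ℤ.+ + ∣ + (d + q) ℤ.- + (d + p) ∣       ≡⟨ cong (λ k → + (e + ∣ k ∣)) (trans (ℤ.m-n≡m⊖n (d + q) (d + p)) (ℤ.+-cancelˡ-⊖ d q p)) ⟩
    + (e + ∣ q ℤ.⊖ p ∣)                         ≡⟨ cong (λ k → + (e + k)) (trans (∣m⊖n∣≡m+n (swap p≡0⊎q≡0)) (+-comm q p)) ⟩
    + (e + (p + q))                             ≡⟨ cong +_ (sym (+-assoc e p q)) ⟩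
    + (e + p + q)                               ∎
    where open ≡-Reasoning

  cᵣ≡ : cᵣ a r ≡ + p ℤ.- + q
  cᵣ≡ = trans (cong₂ ℤ._-_ φ₃≡ φ₁≡) (cancel (+ d) (+ p) (+ q))
    where
    cancel : ∀ d p q → (d ℤ.+ p) ℤ.- (d ℤ.+ q) ≡ p ℤ.- q
    cancel = ℤ-Ring.solve-∀

  0≤φ₁ : + 0 ℤ.≤ φ₁ a r
  0≤φ₁ = subst (+ 0 ℤ.≤_) (sym φ₁≡) (ℤ.+≤+ z≤n)

Representation : ℕ → ℕ → Set
Representation a r = ∃[ d ] ∃[ i ] ∃[ c ] (+ 1 ℤ.≤ d × + 0 ℤ.≤ i × InΓ ∣ i ∣ c
  × + r ≡ (+ a ℤ.+ + 1) ℤ.* (+ 2 ℤ.* d ℤ.- + 2 ℤ.+ i) ℤ.+ c)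

balanced⇒representation : ∀ {a r x z} m y p q → p ≡ 0 ⊎ q ≡ 0 → x ≡ m + q → z ≡ m + p →
  x * a + y * (a + 1) + z * (a + 2) ≡ r → Representation a r
balanced⇒representation {a} {r} m y p q p≡0⊎q≡0 refl refl w =
  + suc (m + y / 2) , + (y % 2 + p + q) , + p ℤ.- + q , ℤ.+≤+ (s≤s z≤n) , ℤ.+≤+ z≤n ,
  ΓDecomposition⇒InΓ (decompose (y % 2) p q (≤-pred (m%n<n y 2)) p≡0⊎q≡0) ,
  Equivalence.from (representation-equation⇔ a r (m + y / 2) (y % 2 + p + q) p q) (begin
    r + q                                                   ≡⟨ cong (_+ q) (sym w) ⟩
    (m + q) * a + y * (a + 1) + (m + p) * (a + 2) + q       ≡⟨ cong (λ k → (m + q) * a + k * (a + 1) + (m + p) * (a + 2) + q) y≡ ⟩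
    _                                                       ≡⟨ shape-identity a m (y / 2) (y % 2) p q ⟩
    (a + 1) * (2 * (m + y / 2) + (y % 2 + p + q)) + p       ∎)
  where
  open ≡-Reasoning
  y≡ : y ≡ y % 2 + 2 * (y / 2)
  y≡ = trans (m≡m%n+[m/n]*n y 2) (cong (λ k → y % 2 + k) (*-comm (y / 2) 2))

factorization⇒representation : ∀ a r → F a r → Representation a r
factorization⇒representation a r ((x , y , z) , w) with ≤-total x z
... | inj₁ x≤z = balanced⇒representation x y (z ∸ x) 0 (inj₂ refl) (sym (+-identityʳ x)) (sym (m+[n∸m]≡n x≤z)) w
... | inj₂ z≤x = balanced⇒representation z y 0 (x ∸ z) (inj₁ refl) (sym (m+[n∸m]≡n z≤x)) (sym (+-identityʳ z)) w

fibre-characterization : ∀ a .{{_ : NonZero a}} {r i c} d → r < L a → ΓDecomposition i c →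
  + r ≡ (+ a ℤ.+ + 1) ℤ.* (+ 2 ℤ.* + suc d ℤ.- + 2 ℤ.+ + i) ℤ.+ c →
  (Fin (suc d) ↔ F a r) × + 0 ℤ.≤ φ₁ a r × + i ≡ ι a r × c ≡ cᵣ a r
    × + 2 ℤ.* + suc d ℤ.- + 2 ℤ.+ + i ≡ + ℓ a r
fibre-characterization a {r} d r<L (decompose e p q e≤1 p≡0⊎q≡0) eq =
  Fin↔F , 0≤φ₁ , sym ι≡ , sym cᵣ≡ , trans (2[1+d]-2+i≡2d+i d (e + p + q)) (cong +_ (sym ℓ≡n))
  where open Fibre a {d = d} r<L e≤1 p≡0⊎q≡0 (Equivalence.to (representation-equation⇔ a r d (e + p + q) p q) eq)

characterization : ∀ a .{{_ : NonZero a}} {r} → r < L a → (d i c : ℤ) →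
  + 1 ℤ.≤ d → + 0 ℤ.≤ i → InΓ ∣ i ∣ c → + r ≡ (+ a ℤ.+ + 1) ℤ.* (+ 2 ℤ.* d ℤ.- + 2 ℤ.+ i) ℤ.+ c →
  (Fin ∣ d ∣ ↔ F a r) × + 0 ℤ.≤ φ₁ a r × i ≡ ι a r × c ≡ cᵣ a r × + 2 ℤ.* d ℤ.- + 2 ℤ.+ i ≡ + ℓ a r
characterization a r<L (+ suc d) (+ i) c _ _ c∈Γᵢ = fibre-characterization a d r<L (InΓ⇒ΓDecomposition i c c∈Γᵢ)
characterization a r<L (+ 0) _ _ (ℤ.+≤+ ())
characterization a r<L -[1+ _ ] _ _ ()

representation⇒factorization : ∀ a .{{_ : NonZero a}} {r} → r < L a → Representation a r → F a r
representation⇒factorization a r<L (d , i , c , 1≤d@(ℤ.+≤+ (s≤s _)) , 0≤i , c∈Γᵢ , eq) =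
  Inverse.to (proj₁ (characterization a r<L d i c 1≤d 0≤i c∈Γᵢ eq)) zero

theorem3p4 : (a : ℕ) → .{{_ : NonZero a}} → 3 ≤ a → (r : ℕ) → r < L a →
    (InS a r ⇔ (∃[ d ] ∃[ i ] ∃[ c ] (+ 1 ℤ.≤ d × + 0 ℤ.≤ i × InΓ ∣ i ∣ c
        × + r ≡ (+ a ℤ.+ + 1) ℤ.* (+ 2 ℤ.* d ℤ.- + 2 ℤ.+ i) ℤ.+ c)))
    × ((d i c : ℤ) → + 1 ℤ.≤ d → + 0 ℤ.≤ i → InΓ ∣ i ∣ c
        → + r ≡ (+ a ℤ.+ + 1) ℤ.* (+ 2 ℤ.* d ℤ.- + 2 ℤ.+ i) ℤ.+ c
        → (Fin ∣ d ∣ ↔ F a r) × + 0 ℤ.≤ φ₁ a r × i ≡ ι a r × c ≡ cᵣ a r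
          × + 2 ℤ.* d ℤ.- + 2 ℤ.+ i ≡ + ℓ a r)
theorem3p4 a _ r r<L =
  mk⇔ (factorization⇒representation a r) (representation⇒factorization a r<L) ,
  characterization a r<L
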